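{- For all integers $k,n\ge0$, $$\sum_{i=0}^n\sum_{j=0}^{n-i}(-1)^i\binom{n-i}{j}\binom{k}{i}\binom{k}{j}=1.$$ -}

module Defs where

open import Data.Nat using (ℕ; zero; suc)
open import Data.Integer using (ℤ; _+_; _*_; -_; +_)

sumTo : ℕ → (ℕ → ℤ) → ℤ
sumTo zero    f = f zero
sumTo (suc n) f = sumTo n f + f (suc n)

negOnePow : ℕ → ℤ
negOnePow zero    = + 1
negOnePow (suc i) = - negOnePow i

-- The sequences aₖ(i) = (-1)^i C(k,i) and dₖ(m) = Σⱼ C(m,j) C(k,j) have generating
-- functions (1 - x)^k and (1 - x)^-(k+1), so their convolution is 1/(1 - x), the constant
-- sequence 1. Without generating functions: Pascal's rule makes aₖ₊₁ the difference
-- sequence of aₖ and dₖ₊₁ the sequence of partial sums of dₖ, and differencing one factor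
-- of a convolution while summing the other leaves the convolution unchanged. Induction on k
-- thus reduces the claim to k = 0, where a₀ is the unit sequence (1, 0, 0, …) and d₀ = 1.
module Submission where

open import Defs
open import Data.Nat using (ℕ; zero; suc; _∸_; _≤_; z≤n)
open import Data.Nat.Combinatorics using (_C_; nCk+nC[k+1]≡[n+1]C[k+1]; k>n⇒nCk≡0)
open import Data.Nat.Properties using (≤-refl; m≤n⇒m≤1+n; n<1+n; n∸n≡0; +-∸-assoc)
open import Data.Integer using (ℤ; _+_; _-_; -_; _*_; +_)
open import Data.Integer.Properties
  using (+-assoc; +-identityʳ; *-identityˡ; *-zeroʳ; *-distribˡ-+; *-distribʳ-+)
open import Data.Integer.Tactic.RingSolver using (solve-∀)
open import Relation.Binary.PropositionalEquality using (_≡_; refl; sym; trans; cong; cong₂)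
open Relation.Binary.PropositionalEquality.≡-Reasoning

sumTo-cong : ∀ n {f g : ℕ → ℤ} → (∀ i → i ≤ n → f i ≡ g i) → sumTo n f ≡ sumTo n g
sumTo-cong zero    f≗g = f≗g 0 z≤n
sumTo-cong (suc n) f≗g =
  cong₂ _+_ (sumTo-cong n (λ i i≤n → f≗g i (m≤n⇒m≤1+n i≤n))) (f≗g (suc n) ≤-refl)

sumTo-zeros : ∀ n (f : ℕ → ℤ) → (∀ i → f i ≡ + 0) → sumTo n f ≡ + 0
sumTo-zeros zero    f f≗0 = f≗0 0
sumTo-zeros (suc n) f f≗0 = cong₂ _+_ (sumTo-zeros n f f≗0) (f≗0 (suc n))

sumTo-+ : ∀ n (f g : ℕ → ℤ) → sumTo n (λ i → f i + g i) ≡ sumTo n f + sumTo n g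
sumTo-+ zero    f g = refl
sumTo-+ (suc n) f g = trans (cong (_+ (f (suc n) + g (suc n))) (sumTo-+ n f g))
  (interchange (sumTo n f) (sumTo n g) (f (suc n)) (g (suc n)))
  where
  interchange : ∀ a b c d → a + b + (c + d) ≡ a + c + (b + d)
  interchange = solve-∀

sumTo-- : ∀ n (f g : ℕ → ℤ) → sumTo n (λ i → f i - g i) ≡ sumTo n f - sumTo n g
sumTo-- zero    f g = refl
sumTo-- (suc n) f g = trans (cong (_+ (f (suc n) - g (suc n))) (sumTo-- n f g))
  (interchange (sumTo n f) (sumTo n g) (f (suc n)) (g (suc n)))
  where
  interchange : ∀ a b c d → a - b + (c - d) ≡ a + c - (b + d)
  interchange = solve-∀

sumTo-*ˡ : ∀ n c (f : ℕ → ℤ) → sumTo n (λ i → c * f i) ≡ c * sumTo n f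
sumTo-*ˡ zero    c f = refl
sumTo-*ˡ (suc n) c f =
  trans (cong (_+ c * f (suc n)) (sumTo-*ˡ n c f)) (sym (*-distribˡ-+ c (sumTo n f) (f (suc n))))

sumTo-suc : ∀ n (f : ℕ → ℤ) → sumTo (suc n) f ≡ f 0 + sumTo n (λ i → f (suc i))
sumTo-suc zero    f = refl
sumTo-suc (suc n) f = trans (cong (_+ f (suc (suc n))) (sumTo-suc n f)) (+-assoc (f 0) _ _)

binomial : ℕ → ℕ → ℤ
binomial n k = + (n C k)

binomial-pascal : ∀ m j → binomial (suc m) (suc j) ≡ binomial m j + binomial m (suc j)
binomial-pascal m j = cong +_ (sym (nCk+nC[k+1]≡[n+1]C[k+1] m j))

binomialSum : ℕ → (ℕ → ℤ) → ℤ
binomialSum m g = sumTo m (λ j → binomial m j * g j)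

binomialSum-+ : ∀ m (f g : ℕ → ℤ) →
  binomialSum m (λ j → f j + g j) ≡ binomialSum m f + binomialSum m g
binomialSum-+ m f g =
  trans (sumTo-cong m (λ j _ → *-distribˡ-+ (binomial m j) (f j) (g j))) (sumTo-+ m _ _)

binomialSum-unfold : ∀ m (g : ℕ → ℤ) →
  binomialSum m g ≡ g 0 + sumTo m (λ j → binomial m (suc j) * g (suc j))
binomialSum-unfold m g = begin
  binomialSum m g
    ≡⟨ sym (+-identityʳ _) ⟩
  binomialSum m g + + 0 * g (suc m)
    ≡⟨ cong (λ c → binomialSum m g + + c * g (suc m)) (sym (k>n⇒nCk≡0 (n<1+n m))) ⟩
  sumTo (suc m) (λ j → binomial m j * g j)
    ≡⟨ sumTo-suc m _ ⟩
  + 1 * g 0 + sumTo m (λ j → binomial m (suc j) * g (suc j))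
    ≡⟨ cong (_+ sumTo m (λ j → binomial m (suc j) * g (suc j))) (*-identityˡ (g 0)) ⟩
  g 0 + sumTo m (λ j → binomial m (suc j) * g (suc j)) ∎

binomialSum-suc : ∀ m (g : ℕ → ℤ) →
  binomialSum (suc m) g ≡ binomialSum m (λ j → g j + g (suc j))
binomialSum-suc m g = begin
  binomialSum (suc m) g
    ≡⟨ sumTo-suc m _ ⟩
  + 1 * g 0 + sumTo m (λ j → binomial (suc m) (suc j) * g (suc j))
    ≡⟨ cong₂ _+_ (*-identityˡ (g 0)) (sumTo-cong m (λ j _ → pascal-term j)) ⟩
  g 0 + sumTo m (λ j → binomial m j * g (suc j) + binomial m (suc j) * g (suc j))
    ≡⟨ cong (_+_ (g 0)) (sumTo-+ m _ _) ⟩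
  g 0 + (binomialSum m (λ j → g (suc j)) + sumTo m (λ j → binomial m (suc j) * g (suc j)))
    ≡⟨ rotate (g 0) _ _ ⟩
  g 0 + sumTo m (λ j → binomial m (suc j) * g (suc j)) + binomialSum m (λ j → g (suc j))
    ≡⟨ cong (_+ binomialSum m (λ j → g (suc j))) (sym (binomialSum-unfold m g)) ⟩
  binomialSum m g + binomialSum m (λ j → g (suc j))
    ≡⟨ sym (binomialSum-+ m g (λ j → g (suc j))) ⟩
  binomialSum m (λ j → g j + g (suc j)) ∎
  where
  pascal-term : ∀ j → binomial (suc m) (suc j) * g (suc j)
                    ≡ binomial m j * g (suc j) + binomial m (suc j) * g (suc j)
  pascal-term j = trans (cong (_* g (suc j)) (binomial-pascal m j))
                        (*-distribʳ-+ (g (suc j)) (binomial m j) (binomial m (suc j)))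
  rotate : ∀ a b c → a + (b + c) ≡ a + c + b
  rotate = solve-∀

-- By Vandermonde's identity this is C(m + k, k); only the recurrences below are needed.
binomialProducts : ℕ → ℕ → ℤ
binomialProducts k m = binomialSum m (binomial k)

binomialProducts-zero : ∀ m → binomialProducts 0 m ≡ + 1
binomialProducts-zero m =
  trans (binomialSum-unfold m (binomial 0))
        (cong (_+_ (+ 1)) (sumTo-zeros m _ (λ j → *-zeroʳ (binomial m (suc j)))))

binomialProducts-pascal : ∀ k m →
  binomialProducts (suc k) (suc m) ≡ binomialProducts (suc k) m + binomialProducts k (suc m)
binomialProducts-pascal k m = begin
  binomialSum (suc m) (binomial (suc k))
    ≡⟨ binomialSum-suc m _ ⟩
  binomialSum m (λ j → binomial (suc k) j + binomial (suc k) (suc j))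
    ≡⟨ sumTo-cong m (λ j _ →
         cong (λ x → binomial m j * (binomial (suc k) j + x)) (binomial-pascal k j)) ⟩
  binomialSum m (λ j → binomial (suc k) j + (binomial k j + binomial k (suc j)))
    ≡⟨ binomialSum-+ m _ _ ⟩
  binomialSum m (binomial (suc k)) + binomialSum m (λ j → binomial k j + binomial k (suc j))
    ≡⟨ cong (_+_ (binomialProducts (suc k) m)) (sym (binomialSum-suc m (binomial k))) ⟩
  binomialProducts (suc k) m + binomialProducts k (suc m) ∎

partialSums : (ℕ → ℤ) → ℕ → ℤ
partialSums b n = sumTo n b

difference : (ℕ → ℤ) → ℕ → ℤ
difference a zero    = a zero
difference a (suc n) = a (suc n) - a n

difference-cong : ∀ {f g : ℕ → ℤ} → (∀ n → f n ≡ g n) → ∀ n → difference f n ≡ difference g n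
difference-cong f≗g zero    = f≗g zero
difference-cong f≗g (suc n) = cong₂ _-_ (f≗g (suc n)) (f≗g n)

difference-partialSums : ∀ (b : ℕ → ℤ) n → difference (partialSums b) n ≡ b n
difference-partialSums b zero    = refl
difference-partialSums b (suc n) = cancel (sumTo n b) (b (suc n))
  where
  cancel : ∀ s x → s + x - s ≡ x
  cancel = solve-∀

binomialProducts-suc : ∀ k m → binomialProducts (suc k) m ≡ partialSums (binomialProducts k) m
binomialProducts-suc k zero    = refl
binomialProducts-suc k (suc m) =
  trans (binomialProducts-pascal k m)
        (cong (_+ binomialProducts k (suc m)) (binomialProducts-suc k m))

_⋆_ : (ℕ → ℤ) → (ℕ → ℤ) → ℕ → ℤ
(a ⋆ b) n = sumTo n (λ i → a i * b (n ∸ i))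

⋆-cong : ∀ {a a′ b b′ : ℕ → ℤ} → (∀ i → a i ≡ a′ i) → (∀ m → b m ≡ b′ m) →
  ∀ n → (a ⋆ b) n ≡ (a′ ⋆ b′) n
⋆-cong a≗a′ b≗b′ n = sumTo-cong n (λ i _ → cong₂ _*_ (a≗a′ i) (b≗b′ (n ∸ i)))

⋆-partialSums : ∀ (a b : ℕ → ℤ) n → (a ⋆ partialSums b) n ≡ partialSums (a ⋆ b) n
⋆-partialSums a b zero    = refl
⋆-partialSums a b (suc n) = begin
  sumTo n (λ i → a i * partialSums b (suc n ∸ i)) + a (suc n) * partialSums b (n ∸ n)
    ≡⟨ cong₂ _+_ (sumTo-cong n split) (cong (a (suc n) *_) last) ⟩
  sumTo n (λ i → a i * partialSums b (n ∸ i) + a i * b (suc n ∸ i)) + a (suc n) * b (n ∸ n)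
    ≡⟨ cong (_+ a (suc n) * b (n ∸ n)) (sumTo-+ n _ _) ⟩
  (a ⋆ partialSums b) n + sumTo n (λ i → a i * b (suc n ∸ i)) + a (suc n) * b (n ∸ n)
    ≡⟨ +-assoc ((a ⋆ partialSums b) n) _ (a (suc n) * b (n ∸ n)) ⟩
  (a ⋆ partialSums b) n + (a ⋆ b) (suc n)
    ≡⟨ cong (_+ (a ⋆ b) (suc n)) (⋆-partialSums a b n) ⟩
  partialSums (a ⋆ b) (suc n) ∎
  where
  suc-∸ : ∀ i → i ≤ n → suc n ∸ i ≡ suc (n ∸ i)
  suc-∸ i i≤n = +-∸-assoc 1 i≤n
  split : ∀ i → i ≤ n →
    a i * partialSums b (suc n ∸ i) ≡ a i * partialSums b (n ∸ i) + a i * b (suc n ∸ i)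
  split i i≤n rewrite suc-∸ i i≤n = *-distribˡ-+ (a i) _ _
  last : partialSums b (n ∸ n) ≡ b (n ∸ n)
  last rewrite n∸n≡0 n = refl

⋆-difference : ∀ (a b : ℕ → ℤ) n → (difference a ⋆ b) n ≡ difference (a ⋆ b) n
⋆-difference a b zero    = refl
⋆-difference a b (suc n) = begin
  (difference a ⋆ b) (suc n)
    ≡⟨ sumTo-suc n _ ⟩
  a 0 * b (suc n) + sumTo n (λ i → (a (suc i) - a i) * b (n ∸ i))
    ≡⟨ cong (_+_ (a 0 * b (suc n)))
         (trans (sumTo-cong n (λ i _ → distrib (a (suc i)) (a i) (b (n ∸ i)))) (sumTo-- n _ _)) ⟩
  a 0 * b (suc n) + (sumTo n (λ i → a (suc i) * b (n ∸ i)) - (a ⋆ b) n)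
    ≡⟨ reassociate (a 0 * b (suc n)) (sumTo n (λ i → a (suc i) * b (n ∸ i))) ((a ⋆ b) n) ⟩
  a 0 * b (suc n) + sumTo n (λ i → a (suc i) * b (n ∸ i)) - (a ⋆ b) n
    ≡⟨ cong (_- (a ⋆ b) n) (sym (sumTo-suc n _)) ⟩
  (a ⋆ b) (suc n) - (a ⋆ b) n ∎
  where
  distrib : ∀ x y z → (x - y) * z ≡ x * z - y * z
  distrib = solve-∀
  reassociate : ∀ x y z → x + (y - z) ≡ x + y - z
  reassociate = solve-∀

difference-⋆-partialSums : ∀ (a b : ℕ → ℤ) n → (difference a ⋆ partialSums b) n ≡ (a ⋆ b) n
difference-⋆-partialSums a b n = begin
  (difference a ⋆ partialSums b) n       ≡⟨ ⋆-difference a (partialSums b) n ⟩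
  difference (a ⋆ partialSums b) n       ≡⟨ difference-cong (⋆-partialSums a b) n ⟩
  difference (partialSums (a ⋆ b)) n     ≡⟨ difference-partialSums (a ⋆ b) n ⟩
  (a ⋆ b) n                              ∎

signedBinomial : ℕ → ℕ → ℤ
signedBinomial k i = negOnePow i * binomial k i

signedBinomial-suc : ∀ k i → signedBinomial (suc k) i ≡ difference (signedBinomial k) i
signedBinomial-suc k zero    = refl
signedBinomial-suc k (suc i) =
  trans (cong (negOnePow (suc i) *_) (binomial-pascal k i)) (distrib (negOnePow i) _ _)
  where
  distrib : ∀ s x y → - s * (x + y) ≡ - s * y - s * x
  distrib = solve-∀

signedBinomial-zero-⋆ : ∀ (b : ℕ → ℤ) n → (signedBinomial 0 ⋆ b) n ≡ b n
signedBinomial-zero-⋆ b zero    = *-identityˡ (b 0)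
signedBinomial-zero-⋆ b (suc n) = begin
  (signedBinomial 0 ⋆ b) (suc n)
    ≡⟨ sumTo-suc n _ ⟩
  + 1 * b (suc n) + sumTo n (λ i → signedBinomial 0 (suc i) * b (n ∸ i))
    ≡⟨ cong₂ _+_ (*-identityˡ (b (suc n)))
                 (sumTo-zeros n _ (λ i → cong (_* b (n ∸ i)) (*-zeroʳ (negOnePow (suc i))))) ⟩
  b (suc n) + + 0
    ≡⟨ +-identityʳ _ ⟩
  b (suc n) ∎

signedBinomial-⋆-binomialProducts : ∀ k n → (signedBinomial k ⋆ binomialProducts k) n ≡ + 1
signedBinomial-⋆-binomialProducts zero n =
  trans (signedBinomial-zero-⋆ (binomialProducts 0) n) (binomialProducts-zero n)
signedBinomial-⋆-binomialProducts (suc k) n = begin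
  (signedBinomial (suc k) ⋆ binomialProducts (suc k)) n
    ≡⟨ ⋆-cong (signedBinomial-suc k) (binomialProducts-suc k) n ⟩
  (difference (signedBinomial k) ⋆ partialSums (binomialProducts k)) n
    ≡⟨ difference-⋆-partialSums _ _ n ⟩
  (signedBinomial k ⋆ binomialProducts k) n
    ≡⟨ signedBinomial-⋆-binomialProducts k n ⟩
  + 1 ∎

corollary3p4 : (k n : ℕ) →
    sumTo n (λ i → sumTo (n ∸ i) (λ j →
      negOnePow i * (+ ((n ∸ i) C j)) * (+ (k C i)) * (+ (k C j)))) ≡ + 1
corollary3p4 k n =
  trans (sumTo-cong n (λ i _ → inner i)) (signedBinomial-⋆-binomialProducts k n)
  where
  inner : ∀ i →
    sumTo (n ∸ i) (λ j → negOnePow i * binomial (n ∸ i) j * binomial k i * binomial k j)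
      ≡ signedBinomial k i * binomialProducts k (n ∸ i)
  inner i = trans
    (sumTo-cong (n ∸ i) (λ j _ →
      regroup (negOnePow i) (binomial (n ∸ i) j) (binomial k i) (binomial k j)))
    (sumTo-*ˡ (n ∸ i) (signedBinomial k i) (λ j → binomial (n ∸ i) j * binomial k j))
    where
    regroup : ∀ s x c y → s * x * c * y ≡ s * c * (x * y)
    regroup = solve-∀
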